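{- For each positive integer $n$, there is a twisted chain graph of order $n$ that is a permutation graph.
   Context: All graphs are finite and simple. For a positive integer $n$, a twisted chain graph of order $n$ is a graph on $3n^2$ vertices $A\cup B\cup C$ with $A=\{v_1,\dots,v_{n^2}\}$, $B=\{w_1,\dots,w_{n^2}\}$, $C=\{z_{(i,j)}\colon 1\le i,j\le n\}$ such that: for all $x,y,i,j\in\{1,\dots,n\}$ and $k=n(x-1)+y$, $v_k$ is adjacent to $z_{(i,j)}$ iff ($x<i$) or ($x=i$ and $y\le j$); $w_k$ is adjacent to $z_{(i,j)}$ iff ($x<j$) or ($x=j$ and $y\le i$); and the edge relation within $A\cup B$ and within $C$ is arbitrary. A permutation graph is the intersection graph of line segments whose endpoints lie on two parallel lines. -}

module Defs where

open import Level using (0ℓ)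
open import Data.Nat using (ℕ)
open import Data.Fin using (Fin; _<_; _≤_)
open import Data.Product using (_×_; _,_; Σ; ∃)
open import Data.Sum using (_⊎_; inj₁; inj₂)
open import Data.Rational using (ℚ; 0ℚ; _-_; _*_) renaming (_≤_ to _≤ℚ_)
open import Relation.Binary.PropositionalEquality using (_≡_)
open import Relation.Nullary using (¬_)
open import Function.Bundles using (_⇔_)

record SimpleGraph (V : Set) : Set₁ where
  field
    Adj       : V → V → Set
    irrefl    : ∀ v → ¬ Adj v v
    symmetric : ∀ {u v} → Adj u v → Adj v u
open SimpleGraph public

-- A line segment joining the point (top , 1) to the point (bottom , 0),
-- i.e. with endpoints on the two parallel lines y = 1 and y = 0.
record Segment : Set where
  constructor seg
  field
    top    : ℚ
    bottom : ℚ
open Segment public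

-- Two such segments meet iff their endpoint orders on the two lines
-- are not strictly the same (touching at an endpoint counts as meeting).
Intersect : Segment → Segment → Set
Intersect s t = ((top s - top t) * (bottom s - bottom t)) ≤ℚ 0ℚ

IsPermutationGraph : {V : Set} → SimpleGraph V → Set
IsPermutationGraph {V} G =
  Σ (V → Segment) λ σ → ∀ u v → ¬ (u ≡ v) → (Adj G u v ⇔ Intersect (σ u) (σ v))

-- The vertex v_k (k = n(x-1)+y) is  a (x , y) , w_k is  b (x , y),
-- and z_(i,j) is  c (i , j); indices are 0-based elements of Fin n
-- (an order-preserving relabelling of 1..n).
data TCVertex (n : ℕ) : Set where
  a : Fin n × Fin n → TCVertex n
  b : Fin n × Fin n → TCVertex n
  c : Fin n × Fin n → TCVertex n

LexLe : {n : ℕ} → Fin n → Fin n → Fin n → Fin n → Set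
LexLe x y i j = (x < i) ⊎ ((x ≡ i) × (y ≤ j))

-- G (on TCVertex n, i.e. on 3n² vertices) is a twisted chain graph of order n.
-- Edges inside A ∪ B and inside C are unconstrained.
IsTwistedChainGraph : (n : ℕ) → SimpleGraph (TCVertex n) → Set
IsTwistedChainGraph n G =
  (∀ x y i j → (Adj G (a (x , y)) (c (i , j)) ⇔ LexLe x y i j)) ×
  (∀ x y i j → (Adj G (b (x , y)) (c (i , j)) ⇔ LexLe x y j i))

{-# OPTIONS --safe #-}
-- Realise the graph as the intersection graph of segments with rational endpoints. With
-- r(x , y) = n x + y < n² the lexicographic rank, v_k runs from r(x , y) on the top line to
-- n² on the bottom line, w_k from n² to r(x , y), and z_(i,j) from r(i , j) to r(j , i).
-- Every bottom endpoint of a z lies left of that of a v, so v_k meets z_(i,j) iff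
-- r(x , y) ≤ r(i , j); dually w_k meets z_(i,j) iff r(x , y) ≤ r(j , i), and the transposed
-- rank at the bottom of z is the twist.
module Submission where

open import Defs
open import Data.Nat using (ℕ; NonZero)
open import Data.Product using (Σ; _×_; _,_; proj₂)

import Data.Nat as ℕ
import Data.Nat.Properties as ℕ
import Data.Integer as ℤ
import Data.Integer.Properties as ℤ
import Data.Fin as Fin
open import Data.Fin using (Fin; toℕ; combine)
import Data.Fin.Properties as Fin
open import Data.Rational
  using (ℚ; 0ℚ; _≤_; _<_; _-_; _*_; -_; *≤*; *<*; positive; nonNegative)
open import Data.Rational.Literals using (fromℤ)
open import Data.Rational.Properties
  using (+-0-group; +-monoˡ-≤; +-monoˡ-<; +-inverseʳ; +-identityˡ; *-comm; *-zeroʳ;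
         *-cancelˡ-≤-pos; *-monoˡ-≤-nonNeg; <⇒≤)
open import Data.Rational.Solver using (module +-*-Solver)
open import Algebra.Properties.Group +-0-group using (//-rightDividesˡ)
open import Data.Sum using (inj₁; inj₂)
open import Relation.Nullary using (contradiction)
open import Relation.Binary.Definitions using (tri<; tri≈; tri>)
open import Relation.Binary.PropositionalEquality
open import Function.Bundles using (_⇔_; mk⇔)
open import Function.Construct.Composition using (_⇔-∘_)
open import Function.Construct.Symmetry using (⇔-sym)
open import Function.Related.Propositional using (module EquationalReasoning)

private
  variable
    V : Set
    m n : ℕ
    p q : ℚ

p-q≤0⇔p≤q : p - q ≤ 0ℚ ⇔ p ≤ q
p-q≤0⇔p≤q {p} {q} = mk⇔
  (λ p-q≤0 → subst₂ _≤_ (//-rightDividesˡ q p) (+-identityˡ q) (+-monoˡ-≤ q p-q≤0))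
  (λ p≤q → subst (p - q ≤_) (+-inverseʳ q) (+-monoˡ-≤ (- q) p≤q))

p<q⇒0<q-p : p < q → 0ℚ < q - p
p<q⇒0<q-p {p} {q} p<q = subst (_< q - p) (+-inverseʳ p) (+-monoˡ-< (- p) p<q)

pos⇒[*≤0⇔≤0] : 0ℚ < p → p * q ≤ 0ℚ ⇔ q ≤ 0ℚ
pos⇒[*≤0⇔≤0] {p} {q} 0<p = mk⇔
  (λ pq≤0 → *-cancelˡ-≤-pos p {{positive 0<p}} (subst (p * q ≤_) (sym (*-zeroʳ p)) pq≤0))
  (λ q≤0 → subst (p * q ≤_) (*-zeroʳ p) (*-monoˡ-≤-nonNeg p {{nonNegative (<⇒≤ 0<p)}} q≤0))

bottom>⇒Intersect⇔top≤ : ∀ {s t} → bottom t < bottom s → Intersect s t ⇔ top s ≤ top t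
bottom>⇒Intersect⇔top≤ {s} {t} bt<bs
  rewrite *-comm (top s - top t) (bottom s - bottom t)
  = p-q≤0⇔p≤q ⇔-∘ pos⇒[*≤0⇔≤0] (p<q⇒0<q-p bt<bs)

top>⇒Intersect⇔bottom≤ : ∀ {s t} → top t < top s → Intersect s t ⇔ bottom s ≤ bottom t
top>⇒Intersect⇔bottom≤ tt<ts = p-q≤0⇔p≤q ⇔-∘ pos⇒[*≤0⇔≤0] (p<q⇒0<q-p tt<ts)

Intersect-sym : ∀ {s t} → Intersect s t → Intersect t s
Intersect-sym {s} {t} = subst (_≤ 0ℚ) (swap-differences (top s) (top t) (bottom s) (bottom t))
  where
  open +-*-Solver
  swap-differences : ∀ w x y z → (w - x) * (y - z) ≡ (x - w) * (z - y)
  swap-differences = solve 4 (λ w x y z → (w :- x) :* (y :- z) := (x :- w) :* (z :- y)) refl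

IntersectionGraph : (V → Segment) → SimpleGraph V
IntersectionGraph σ = record
  { Adj       = λ u v → u ≢ v × Intersect (σ u) (σ v)
  ; irrefl    = λ v (v≢v , _) → v≢v refl
  ; symmetric = λ {u} {v} (u≢v , meet) → ≢-sym u≢v , Intersect-sym {σ u} {σ v} meet
  }

IntersectionGraph-Adj⇔Intersect : (σ : V → Segment) {u v : V} → u ≢ v →
  Adj (IntersectionGraph σ) u v ⇔ Intersect (σ u) (σ v)
IntersectionGraph-Adj⇔Intersect σ u≢v = mk⇔ proj₂ (u≢v ,_)

IntersectionGraph-isPermutationGraph : (σ : V → Segment) →
  IsPermutationGraph (IntersectionGraph σ)
IntersectionGraph-isPermutationGraph σ = σ , λ u v → IntersectionGraph-Adj⇔Intersect σ

fromℕ : ℕ → ℚ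
fromℕ k = fromℤ (ℤ.+ k)

fromℕ-≤⇔ : m ℕ.≤ n ⇔ fromℕ m ≤ fromℕ n
fromℕ-≤⇔ {m} {n} = mk⇔
  (λ m≤n → *≤* (subst₂ ℤ._≤_ (sym (m*1≡m m)) (sym (m*1≡m n)) (ℤ.+≤+ m≤n)))
  (λ { (*≤* m*1≤n*1) → ℤ.drop‿+≤+ (subst₂ ℤ._≤_ (m*1≡m m) (m*1≡m n) m*1≤n*1) })
  where m*1≡m = λ k → ℤ.*-identityʳ (ℤ.+ k)

fromℕ-mono-< : m ℕ.< n → fromℕ m < fromℕ n
fromℕ-mono-< {m} {n} m<n = *<* (subst₂ ℤ._<_ (sym (m*1≡m m)) (sym (m*1≡m n)) (ℤ.+<+ m<n))
  where m*1≡m = λ k → ℤ.*-identityʳ (ℤ.+ k)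

combine-monoʳ-≤ : (i : Fin m) {j k : Fin n} → j Fin.≤ k → combine i j Fin.≤ combine i k
combine-monoʳ-≤ {n = n} i {j} {k} j≤k =
  subst₂ ℕ._≤_ (sym (Fin.toℕ-combine i j)) (sym (Fin.toℕ-combine i k)) (ℕ.+-monoʳ-≤ (n ℕ.* toℕ i) j≤k)

combine-cancelʳ-≤ : (i : Fin m) {j k : Fin n} → combine i j Fin.≤ combine i k → j Fin.≤ k
combine-cancelʳ-≤ {n = n} i {j} {k} cij≤cik = ℕ.+-cancelˡ-≤ (n ℕ.* toℕ i) (toℕ j) (toℕ k)
  (subst₂ ℕ._≤_ (Fin.toℕ-combine i j) (Fin.toℕ-combine i k) cij≤cik)

LexLe⇔combine≤ : (x y i j : Fin n) → LexLe x y i j ⇔ combine x y Fin.≤ combine i j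
LexLe⇔combine≤ x y i j = mk⇔ to from
  where
  to : LexLe x y i j → combine x y Fin.≤ combine i j
  to (inj₁ x<i)          = ℕ.<⇒≤ (Fin.combine-monoˡ-< y j x<i)
  to (inj₂ (refl , y≤j)) = combine-monoʳ-≤ x y≤j
  from : combine x y Fin.≤ combine i j → LexLe x y i j
  from cxy≤cij with Fin.<-cmp x i
  ... | tri< x<i _ _ = inj₁ x<i
  ... | tri≈ _ refl _ = inj₂ (refl , combine-cancelʳ-≤ x cxy≤cij)
  ... | tri> _ _ i<x = contradiction cxy≤cij (ℕ.<⇒≱ (Fin.combine-monoˡ-< j y i<x))

rank : Fin n × Fin n → ℚ
rank (x , y) = fromℕ (toℕ (combine x y))

LexLe⇔rank≤ : (x y i j : Fin n) → LexLe x y i j ⇔ rank (x , y) ≤ rank (i , j)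
LexLe⇔rank≤ x y i j = fromℕ-≤⇔ ⇔-∘ LexLe⇔combine≤ x y i j

rank<n² : (p : Fin n × Fin n) → rank p < fromℕ (n ℕ.* n)
rank<n² (x , y) = fromℕ-mono-< (Fin.toℕ<n (combine x y))

segment : TCVertex n → Segment
segment {n} (a p)       = seg (rank p) (fromℕ (n ℕ.* n))
segment {n} (b p)       = seg (fromℕ (n ℕ.* n)) (rank p)
segment     (c (i , j)) = seg (rank (i , j)) (rank (j , i))

segment-isTwistedChainGraph : ∀ n → IsTwistedChainGraph n (IntersectionGraph (segment {n}))
segment-isTwistedChainGraph n = ac , bc
  where
  open EquationalReasoning
  G = IntersectionGraph (segment {n})

  ac : ∀ x y i j → Adj G (a (x , y)) (c (i , j)) ⇔ LexLe x y i j
  ac x y i j = begin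
    Adj G (a (x , y)) (c (i , j))                         ∼⟨ IntersectionGraph-Adj⇔Intersect segment (λ ()) ⟩
    Intersect (segment (a (x , y))) (segment (c (i , j))) ∼⟨ bottom>⇒Intersect⇔top≤ (rank<n² (j , i)) ⟩
    rank (x , y) ≤ rank (i , j)                           ∼⟨ ⇔-sym (LexLe⇔rank≤ x y i j) ⟩
    LexLe x y i j                                         ∎

  bc : ∀ x y i j → Adj G (b (x , y)) (c (i , j)) ⇔ LexLe x y j i
  bc x y i j = begin
    Adj G (b (x , y)) (c (i , j))                         ∼⟨ IntersectionGraph-Adj⇔Intersect segment (λ ()) ⟩
    Intersect (segment (b (x , y))) (segment (c (i , j))) ∼⟨ top>⇒Intersect⇔bottom≤ (rank<n² (i , j)) ⟩
    rank (x , y) ≤ rank (j , i)                           ∼⟨ ⇔-sym (LexLe⇔rank≤ x y j i) ⟩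
    LexLe x y j i                                         ∎

lemma9 : (n : ℕ) → .{{_ : NonZero n}} →
    Σ (SimpleGraph (TCVertex n)) λ G → IsTwistedChainGraph n G × IsPermutationGraph G
lemma9 n = IntersectionGraph segment
         , segment-isTwistedChainGraph n
         , IntersectionGraph-isPermutationGraph segment
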